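{- Let $H_{\mathrm{cor},\mathbb{F}_2}$ be the corner hypergraph of the group $\mathbb{F}_2 = \mathbb{Z}/2\mathbb{Z}$. Then $\beta(H_{\mathrm{cor},\mathbb{F}_2}^{\boxtimes 2}) \geq 11$ and $\beta(H_{\mathrm{cor},\mathbb{F}_2}^{\boxtimes 3}) \geq 39$; as a consequence, $\Theta(H_{\mathrm{cor},\mathbb{F}_2}) \geq \sqrt[3]{39}$.
   Context: A directed $k$-uniform hypergraph is a pair $H=(V,E)$ with $V$ a finite set and $E$ a set of $k$-tuples of elements of $V$. The strong product $G\boxtimes H$ of directed $k$-uniform hypergraphs $G=(V_G,E_G)$, $H=(V_H,E_H)$ has vertex set $V_G\times V_H$, and $((g_1,h_1),\dots,(g_k,h_k))$ is an edge iff either ($g_1=\dots=g_k$ and $(h_1,\dots,h_k)\in E_H$), or ($(g_1,\dots,g_k)\in E_G$ and $h_1=\dots=h_k$), or ($(g_1,\dots,g_k)\in E_G$ and $(h_1,\dots,h_k)\in E_H$). $H^{\boxtimes n}$ is the $n$-fold strong product of $H$ with itself. An independent set of $H$ is a set $S\subseteq V$ such that no edge has all its coordinates in $S$; $\alpha(H)$ is the maximum size of an independent set. The Shannon capacity is $\Theta(H)=\lim_{n\to\infty}\alpha(H^{\boxtimes n})^{1/n}$. For a finite abelian group $G$, the corner hypergraph $H_{\mathrm{cor},G}$ is the directed $3$-uniform hypergraph with vertex set $G\times G$ and edge set $\{((g_1,g_2),(g_1+\lambda,g_2),(g_1,g_2+\lambda)) : g_1,g_2,\lambda\in G,\ \lambda\neq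 0\}$. Combinatorial degeneration: for finite sets $I_1,\dots,I_k$ and $\Phi\subseteq\Psi\subseteq I_1\times\dots\times I_k$, we write $\Psi\unrhd\Phi$ if there are maps $u_i:I_i\to\mathbb{Z}$ ($i\in[k]$) such that for every $x=(x_1,\dots,x_k)\in\Psi\setminus\Phi$ we have $\sum_i u_i(x_i)>0$ and for every $x\in\Phi$ we have $\sum_i u_i(x_i)=0$. For a directed $k$-uniform hypergraph $H=(V,E)$, $\beta(H)$ is the largest size of a subset $S\subseteq V$ such that $E\cup\{(v,\dots,v):v\in V\}\unrhd\{(v,\dots,v):v\in S\}$. -}

module Defs where

open import Level using (0ℓ)
open import Data.Nat as ℕ using (ℕ; zero; suc)
open import Data.Integer as ℤ using (ℤ; 0ℤ)
open import Data.Fin using (Fin; zero; suc)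
open import Data.Product using (Σ; ∃; _×_; _,_; proj₁; proj₂)
open import Data.Sum using (_⊎_)
open import Data.Unit using (⊤; tt)
open import Data.Empty using (⊥)
open import Function.Definitions using (Injective)
open import Relation.Nullary using (¬_)
open import Relation.Binary.PropositionalEquality using (_≡_; _≢_)

record Hypergraph (k : ℕ) : Set₁ where
  field
    V : Set
    E : (Fin k → V) → Set
open Hypergraph public

IsConst : ∀ {k} {A : Set} → (Fin k → A) → A → Set
IsConst {k} x a = ∀ (i : Fin k) → x i ≡ a

_⊠_ : ∀ {k} → Hypergraph k → Hypergraph k → Hypergraph k
_⊠_ {k} G H = record
  { V = V G × V H
  ; E = λ x →
      let g = λ i → proj₁ (x i) ; h = λ i → proj₂ (x i) in
        ((∃ λ g₀ → IsConst g g₀) × E H h)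
      ⊎ (E G g × (∃ λ h₀ → IsConst h h₀))
      ⊎ (E G g × E H h)
  }

𝟙 : ∀ {k} → Hypergraph k
𝟙 = record { V = ⊤ ; E = λ _ → ⊥ }

-- n-fold strong power; H ^⊠ 1 is (up to the obvious isomorphism) H
_^⊠_ : ∀ {k} → Hypergraph k → ℕ → Hypergraph k
H ^⊠ zero = 𝟙
H ^⊠ suc n = (H ^⊠ n) ⊠ H

-- A subset S ⊆ V of size m, given by an injective enumeration f : Fin m → V
-- (S = image of f).  Membership of v in S:
_∈S_ : ∀ {m} {V : Set} → V → (Fin m → V) → Set
v ∈S f = ∃ λ j → v ≡ f j

IsIndependent : ∀ {k m} (H : Hypergraph k) → (Fin m → V H) → Set
IsIndependent H f = ∀ (e : Fin _ → V H) → E H e → ¬ (∀ i → e i ∈S f)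

α≥ : ∀ {k} → Hypergraph k → ℕ → Set
α≥ H m = Σ (Fin m → V H) λ f → Injective _≡_ _≡_ f × IsIndependent H f

sumFin : ∀ {k} → (Fin k → ℤ) → ℤ
sumFin {zero} a = 0ℤ
sumFin {suc k} a = a zero ℤ.+ sumFin (λ i → a (suc i))

-- Combinatorial degeneration Ψ ⊵ Φ on I₁ × ... × Iₖ with all Iᵢ = I
-- (Φ ⊆ Ψ as predicates).  Maps uᵢ : I → ℤ given as u : Fin k → I → ℤ.
Degen : ∀ {k} {I : Set} → (Ψ Φ : (Fin k → I) → Set) → Set
Degen {k} {I} Ψ Φ = Σ (Fin k → I → ℤ) λ u →
    (∀ x → Ψ x → ¬ Φ x → ℤ.0ℤ ℤ.< sumFin (λ i → u i (x i)))
  × (∀ x → Φ x → sumFin (λ i → u i (x i)) ≡ 0ℤ)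

β≥ : ∀ {k} → Hypergraph k → ℕ → Set
β≥ H m = Σ (Fin m → V H) λ f → Injective _≡_ _≡_ f ×
  Degen (λ x → E H x ⊎ (∃ λ v → IsConst x v))
        (λ x → ∃ λ v → v ∈S f × IsConst x v)

_⊕_ : Fin 2 → Fin 2 → Fin 2
zero ⊕ b = b
suc zero ⊕ zero = suc zero
suc zero ⊕ suc zero = zero

Hcor𝔽₂ : Hypergraph 3
Hcor𝔽₂ = record
  { V = Fin 2 × Fin 2
  ; E = λ x → ∃ λ g₁ → ∃ λ g₂ → ∃ λ l → l ≢ zero
          × x zero ≡ (g₁ , g₂)
          × x (suc zero) ≡ (g₁ ⊕ l , g₂)
          × x (suc (suc zero)) ≡ (g₁ , g₂ ⊕ l)
  }

{-# OPTIONS --safe #-}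
-- A degeneration E ∪ Δ ⊵ Δ_S of a loopless 3-uniform G, with weights u₁ u₂ u₃, makes the
-- weight Σᵢ uᵢ of a triple of words in S^n additive over coordinates: it is positive on
-- every edge of G^⊠n and zero on the diagonal.  So on S^n the third weight is determined by
-- the first two, and the words with prescribed first and second weights form an independent
-- set of G^⊠n.  These weights take only polynomially many values, so by pigeonhole
-- α(G^⊠n) ≥ |S|^n / poly(n).  Taking G = H^⊠3 with a 39-element S, and
-- using that (P + 1)^n / P^n outgrows every quadratic, gives α(H^⊠n) ≥ (p/q)^n for large n
-- whenever p³ < 39 q³.  The two degenerations themselves are checked by exhausting the
-- finitely many shapes of edges of powers of the corner hypergraph.
module Submission where

open import Defs
open import Data.Nat using (ℕ; _≤_; _<_; _*_; _^_)
open import Data.Product using (_×_; ∃; Σ)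

open import Data.Nat using (zero; suc; _+_; z≤n; s≤s; NonZero)
open import Data.Nat.Properties
open import Data.Nat.DivMod using (_/_; _%_; m≡m%n+[m/n]*n; m%n<n; m*n/n≡m; /-monoˡ-≤)
open import Data.Nat.Solver using (module +-*-Solver)
open import Data.Integer as ℤ using (ℤ; 0ℤ; +_; -_; -[1+_]; ∣_∣)
import Data.Integer.Properties as ℤ
open import Data.Fin as Fin using (Fin; zero; suc; #_; fromℕ<; combine; finToFun; funToFin)
import Data.Fin.Properties as Fin
open import Data.Bool using (Bool; true; false; T; _∨_; if_then_else_)
open import Data.Bool.Properties using (T?; ∨-comm)
open import Data.Unit using (⊤; tt)
open import Data.Empty using (⊥-elim)
open import Data.Sum using (_⊎_; inj₁; inj₂)
open import Data.Product using (∃₂; _,_; proj₁; proj₂)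
open import Data.Product.Properties using (≡-dec)
open import Data.Vec using (Vec; []; _∷_; lookup)
open import Algebra.Properties.CommutativeMonoid.Sum +-0-commutativeMonoid
  using (sum-syntax; ∑-distrib-+; sum-replicate-zero)
open import Function using (_∘_)
open import Function.Definitions using (Injective)
open import Relation.Nullary using (Dec; yes; no; does; ¬_; contradiction)
open import Relation.Nullary.Decidable using (True; toWitness; map′; _×-dec_; _→-dec_)
open import Relation.Unary using (Decidable)
open import Relation.Binary.Definitions using (DecidableEquality)
open import Relation.Binary.PropositionalEquality
  using (_≡_; _≢_; refl; sym; trans; cong; cong₂; subst; subst₂; module ≡-Reasoning)
open +-*-Solver using (solve; _:+_; _:*_; _:=_; con)

private variable
  k m n K : ℕ
  A B C : Hypergraph k

-- Edges and loops of strong products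

data EdgeOrLoop (G : Hypergraph k) (x : Fin k → V G) : Bool → Set where
  edge : E G x → EdgeOrLoop G x true
  loop : ∀ v → IsConst x v → EdgeOrLoop G x false

⊠-split : ∀ {x b} → EdgeOrLoop (A ⊠ B) x b →
          ∃₂ λ c d → EdgeOrLoop A (proj₁ ∘ x) c × EdgeOrLoop B (proj₂ ∘ x) d × b ≡ c ∨ d
⊠-split (edge (inj₁ ((a , a-const) , eB)))        = false , true , loop a a-const , edge eB , refl
⊠-split (edge (inj₂ (inj₁ (eA , (b , b-const))))) = true , false , edge eA , loop b b-const , refl
⊠-split (edge (inj₂ (inj₂ (eA , eB))))            = true , true , edge eA , edge eB , refl
⊠-split (loop (a , b) c) = false , false , loop a (cong proj₁ ∘ c) , loop b (cong proj₂ ∘ c) , refl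

𝟙-loop : ∀ {x b} → EdgeOrLoop (𝟙 {k}) x b → b ≡ false
𝟙-loop (loop _ _) = refl

Loopless : Hypergraph k → Set
Loopless G = ∀ {x} v → E G x → ¬ IsConst x v

⊠-loopless : Loopless A → Loopless B → Loopless (A ⊠ B)
⊠-loopless _  lB (_ , b) (inj₁ (_ , eB))        c = lB b eB (cong proj₂ ∘ c)
⊠-loopless lA _  (a , _) (inj₂ (inj₁ (eA , _))) c = lA a eA (cong proj₁ ∘ c)
⊠-loopless lA _  (a , _) (inj₂ (inj₂ (eA , _))) c = lA a eA (cong proj₁ ∘ c)

^⊠-loopless : {G : Hypergraph k} → Loopless G → ∀ n → Loopless (G ^⊠ n)
^⊠-loopless lG zero    _ ()
^⊠-loopless lG (suc n) = ⊠-loopless (^⊠-loopless lG n) lG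

-- Homomorphisms with a section

infix 4 _↠_

record _↠_ (A B : Hypergraph k) : Set where
  field
    to      : V A → V B
    to-edge : ∀ {x} → E A x → E B (to ∘ x)
    from    : V B → V A
    to-from : ∀ v → to (from v) ≡ v
open _↠_

↠-refl : A ↠ A
↠-refl = record { to = λ v → v ; to-edge = λ e → e ; from = λ v → v ; to-from = λ _ → refl }

↠-trans : A ↠ B → B ↠ C → A ↠ C
↠-trans φ ψ = record
  { to      = to ψ ∘ to φ
  ; to-edge = to-edge ψ ∘ to-edge φ
  ; from    = from φ ∘ from ψ
  ; to-from = λ v → trans (cong (to ψ) (to-from φ (from ψ v))) (to-from ψ v)
  }

⊠-↠ : {A A′ B B′ : Hypergraph k} → A ↠ A′ → B ↠ B′ → A ⊠ B ↠ A′ ⊠ B′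
⊠-↠ φ ψ = record
  { to      = λ v → to φ (proj₁ v) , to ψ (proj₂ v)
  ; to-edge = λ where
      (inj₁ ((a , c) , eB))        → inj₁ ((to φ a , cong (to φ) ∘ c) , to-edge ψ eB)
      (inj₂ (inj₁ (eA , (b , c)))) → inj₂ (inj₁ (to-edge φ eA , (to ψ b , cong (to ψ) ∘ c)))
      (inj₂ (inj₂ (eA , eB)))      → inj₂ (inj₂ (to-edge φ eA , to-edge ψ eB))
  ; from    = λ v → from φ (proj₁ v) , from ψ (proj₂ v)
  ; to-from = λ v → cong₂ _,_ (to-from φ (proj₁ v)) (to-from ψ (proj₂ v))
  }

⊠-assoc : (A ⊠ B) ⊠ C ↠ A ⊠ (B ⊠ C)
⊠-assoc = record
  { to      = λ v → proj₁ (proj₁ v) , proj₂ (proj₁ v) , proj₂ v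
  ; to-edge = λ where
      (inj₁ (((a , b) , c) , eC)) →
        inj₁ ((a , cong proj₁ ∘ c) , inj₁ ((b , cong proj₂ ∘ c) , eC))
      (inj₂ (inj₁ (inj₁ ((a , c) , eB) , cC))) → inj₁ ((a , c) , inj₂ (inj₁ (eB , cC)))
      (inj₂ (inj₁ (inj₂ (inj₁ (eA , (b , c))) , (cv , c′)))) →
        inj₂ (inj₁ (eA , ((b , cv) , λ i → cong₂ _,_ (c i) (c′ i))))
      (inj₂ (inj₁ (inj₂ (inj₂ (eA , eB)) , cC))) → inj₂ (inj₂ (eA , inj₂ (inj₁ (eB , cC))))
      (inj₂ (inj₂ (inj₁ ((a , c) , eB) , eC))) → inj₁ ((a , c) , inj₂ (inj₂ (eB , eC)))
      (inj₂ (inj₂ (inj₂ (inj₁ (eA , cB)) , eC))) → inj₂ (inj₂ (eA , inj₁ (cB , eC)))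
      (inj₂ (inj₂ (inj₂ (inj₂ (eA , eB)) , eC))) → inj₂ (inj₂ (eA , inj₂ (inj₂ (eB , eC))))
  ; from    = λ v → (proj₁ v , proj₁ (proj₂ v)) , proj₂ (proj₂ v)
  ; to-from = λ _ → refl
  }

^⊠-+ : ∀ {G : Hypergraph k} a {s} → G ^⊠ (a + s) ↠ (G ^⊠ s) ⊠ (G ^⊠ a)
^⊠-+ zero = record
  { to = λ v → v , tt ; to-edge = λ e → inj₂ (inj₁ (e , (tt , λ _ → refl)))
  ; from = proj₁ ; to-from = λ _ → refl }
^⊠-+ {G = G} (suc a) {s} =
  ↠-trans (⊠-↠ (^⊠-+ a) (↠-refl {A = G})) (⊠-assoc {A = G ^⊠ s} {B = G ^⊠ a} {C = G})

^⊠-* : ∀ {G : Hypergraph k} n a → G ^⊠ (n * a) ↠ (G ^⊠ a) ^⊠ n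
^⊠-* zero    a = ↠-refl
^⊠-* {G = G} (suc n) a = ↠-trans (^⊠-+ a) (⊠-↠ (^⊠-* n a) (↠-refl {A = G ^⊠ a}))

α≥-pullback : A ↠ B → α≥ B m → α≥ A m
α≥-pullback φ (f , f-inj , f-indep) =
  from φ ∘ f ,
  (λ {i} {j} eq → f-inj (trans (sym (to-from φ (f i))) (trans (cong (to φ) eq) (to-from φ (f j))))) ,
  λ e eA e∈ → f-indep (to φ ∘ e) (to-edge φ eA) λ i →
    let j , eq = e∈ i in j , trans (cong (to φ) eq) (to-from φ (f j))

α≥-⊠ : Loopless B → V B → α≥ A m → α≥ (A ⊠ B) m
α≥-⊠ {B = B} {A = A} lB b (f , f-inj , f-indep) = (λ j → f j , b) , f-inj ∘ cong proj₁ , indep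
  where
  indep : IsIndependent (A ⊠ B) (λ j → f j , b)
  indep e (inj₁ (_ , eB))        e∈ = lB b eB (cong proj₂ ∘ proj₂ ∘ e∈)
  indep e (inj₂ (inj₁ (eA , _))) e∈ = f-indep _ eA (λ i → proj₁ (e∈ i) , cong proj₁ (proj₂ (e∈ i)))
  indep e (inj₂ (inj₂ (eA , _))) e∈ = f-indep _ eA (λ i → proj₁ (e∈ i) , cong proj₁ (proj₂ (e∈ i)))

α≥-^⊠-+ : {G : Hypergraph k} → Loopless G → V G →
          ∀ r {s} → α≥ (G ^⊠ s) m → α≥ (G ^⊠ (r + s)) m
α≥-^⊠-+ lG g zero    α = α
α≥-^⊠-+ lG g (suc r) α = α≥-⊠ lG g (α≥-^⊠-+ lG g r α)

-- Pigeonhole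

indicator : {K : ℕ} → Fin K → Fin K → ℕ
indicator d c = if does (d Fin.≟ c) then 1 else 0

∑-indicator : (d : Fin K) → ∑[ c < K ] indicator d c ≡ 1
∑-indicator {suc K} zero    = cong suc (sum-replicate-zero K)
∑-indicator {suc K} (suc d) = ∑-indicator d

count : (Fin n → Fin K) → Fin K → ℕ
count {zero}  cls c = 0
count {suc n} cls c = indicator (cls zero) c + count (cls ∘ suc) c

∑-count : (cls : Fin n → Fin K) → ∑[ c < K ] count cls c ≡ n
∑-count {zero} {K} cls = sum-replicate-zero K
∑-count {suc n} cls = trans (∑-distrib-+ (indicator (cls zero)) (count (cls ∘ suc)))
  (cong₂ _+_ (∑-indicator (cls zero)) (∑-count (cls ∘ suc)))

fiber : (cls : Fin n → Fin K) (c : Fin K) →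
        Σ (Fin (count cls c) → Fin n) λ g → Injective _≡_ _≡_ g × (∀ i → cls (g i) ≡ c)
fiber {zero} cls c = (λ ()) , (λ {}) , λ ()
fiber {suc n} cls c with cls zero Fin.≟ c | fiber (cls ∘ suc) c
... | no _    | g , g-inj , g-cls = suc ∘ g , g-inj ∘ Fin.suc-injective , g-cls
... | yes eq  | g , g-inj , g-cls = g′ , g′-inj , λ { zero → eq ; (suc i) → g-cls i }
  where
  g′ : Fin (suc (count (cls ∘ suc) c)) → Fin (suc n)
  g′ zero    = zero
  g′ (suc i) = suc (g i)
  g′-inj : Injective _≡_ _≡_ g′
  g′-inj {zero}  {zero}  _  = refl
  g′-inj {suc i} {suc j} eq = cong suc (g-inj (Fin.suc-injective eq))

∑≤*max : (x : Fin (suc K) → ℕ) → ∃ λ c → ∑[ i < suc K ] x i ≤ suc K * x c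
∑≤*max {zero}  x = zero , ≤-refl
∑≤*max {suc K} x with ∑≤*max (x ∘ suc)
... | c , le with x zero ≤? x (suc c)
...   | yes x₀≤ = suc c , +-mono-≤ x₀≤ le
...   | no  x₀≰ =
  zero , +-monoʳ-≤ (x zero) (≤-trans le (*-monoʳ-≤ (suc K) (<⇒≤ (≰⇒> x₀≰))))

pigeonhole : (cls : Fin n → Fin (suc K)) →
             ∃₂ λ c M → Σ (Fin M → Fin n) λ g →
               Injective _≡_ _≡_ g × (∀ i → cls (g i) ≡ c) × n ≤ suc K * M
pigeonhole {K = K} cls with ∑≤*max (count cls)
... | c , le with fiber cls c
...   | g , g-inj , g-cls =
  c , count cls c , g , g-inj , g-cls , subst (_≤ suc K * count cls c) (∑-count cls) le

-- Independent sets in powers from a degeneration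

StrictIf : Bool → ℕ → ℕ → Set
StrictIf true  m n = m < n
StrictIf false m n = m ≡ n

StrictIf-+ : ∀ b c {m n m′ n′} → StrictIf b m n → StrictIf c m′ n′ →
             StrictIf (b ∨ c) (m + m′) (n + n′)
StrictIf-+ true  true  p    q    = +-mono-<-≤ p (<⇒≤ q)
StrictIf-+ true  false p    refl = +-monoˡ-< _ p
StrictIf-+ false true  refl q    = +-monoʳ-< _ q
StrictIf-+ false false refl refl = refl

≤-∑ : (x : Fin n → ℕ) (i : Fin n) → x i ≤ ∑[ c < n ] x c
≤-∑ x zero    = m≤m+n _ _
≤-∑ x (suc i) = ≤-trans (≤-∑ (x ∘ suc) i) (m≤n+m _ _)

∑-bound : ∀ {B} (x : Fin n → ℕ) → (∀ c → x c ≤ B) → ∑[ c < n ] x c ≤ n * B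
∑-bound {zero}  x x≤ = z≤n
∑-bound {suc n} x x≤ = +-mono-≤ (x≤ zero) (∑-bound (x ∘ suc) (x≤ ∘ suc))

sumFin-cong : {x y : Fin k → ℤ} → (∀ i → x i ≡ y i) → sumFin x ≡ sumFin y
sumFin-cong {zero}  eq = refl
sumFin-cong {suc k} eq = cong₂ ℤ._+_ (eq zero) (sumFin-cong (eq ∘ suc))

∣i∣≤n⇒0≤i+n : ∀ {z R} → ∣ z ∣ ≤ R → 0ℤ ℤ.≤ z ℤ.+ + R
∣i∣≤n⇒0≤i+n {+ _}      _ = ℤ.+≤+ z≤n
∣i∣≤n⇒0≤i+n { -[1+ n ]} {R} le = subst (0ℤ ℤ.≤_) (sym (ℤ.⊖-≥ le)) (ℤ.+≤+ z≤n)

∑-shift : ∀ R (z : Fin k → ℤ) → (∀ i → 0ℤ ℤ.≤ z i ℤ.+ + R) →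
            + ∑[ i < k ] ∣ z i ℤ.+ + R ∣ ≡ sumFin z ℤ.+ + (k * R)
∑-shift {zero}  R z _  = refl
∑-shift {suc k} R z 0≤ = begin
  + (∣ z zero ℤ.+ + R ∣ + ∑[ i < k ] ∣ z (suc i) ℤ.+ + R ∣)
    ≡⟨ ℤ.pos-+ ∣ z zero ℤ.+ + R ∣ (∑[ i < k ] ∣ z (suc i) ℤ.+ + R ∣) ⟩
  + ∣ z zero ℤ.+ + R ∣ ℤ.+ + ∑[ i < k ] ∣ z (suc i) ℤ.+ + R ∣
    ≡⟨ cong₂ ℤ._+_ (ℤ.0≤i⇒+∣i∣≡i (0≤ zero)) (∑-shift R (z ∘ suc) (0≤ ∘ suc)) ⟩
  (z zero ℤ.+ + R) ℤ.+ (sumFin (z ∘ suc) ℤ.+ + (k * R))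
    ≡⟨ interchange (z zero) (+ R) (sumFin (z ∘ suc)) (+ (k * R)) ⟩
  sumFin z ℤ.+ (+ R ℤ.+ + (k * R))
    ≡⟨ cong (λ t → sumFin z ℤ.+ t) (sym (ℤ.pos-+ R (k * R))) ⟩
  sumFin z ℤ.+ + (suc k * R) ∎
  where
  open ≡-Reasoning
  open import Algebra.Properties.CommutativeSemigroup ℤ.+-commutativeSemigroup using (interchange)

finToFun-injective : ∀ {i j : Fin (m ^ n)} → (∀ c → finToFun {m} {n} i c ≡ finToFun j c) → i ≡ j
finToFun-injective {m} {n} {i} {j} eq =
  trans (sym (Fin.funToFin-finToFin {n} {m} i)) (trans (funToFin-cong eq) (Fin.funToFin-finToFin {n} {m} j))
  where
  funToFin-cong : ∀ {k} {x y : Fin k → Fin m} → (∀ c → x c ≡ y c) → funToFin x ≡ funToFin y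
  funToFin-cong {zero}  _  = refl
  funToFin-cong {suc k} eq = cong₂ combine (eq zero) (funToFin-cong (eq ∘ suc))

module PowerWeights
  {G : Hypergraph 3} (G-loopless : Loopless G) {m} (f : Fin m → V G) (f-inj : Injective _≡_ _≡_ f)
  (u : Fin 3 → V G → ℤ)
  (u-pos : ∀ x → E G x ⊎ (∃ λ v → IsConst x v) → ¬ (∃ λ v → v ∈S f × IsConst x v) →
           0ℤ ℤ.< sumFin (λ i → u i (x i)))
  (u-zero : ∀ x → (∃ λ v → v ∈S f × IsConst x v) → sumFin (λ i → u i (x i)) ≡ 0ℤ)
  where

  R : ℕ
  R = ∑[ j < m ] ∑[ i < 3 ] ∣ u i (f j) ∣

  -- Shifting every weight by R makes the weights on S natural numbers; a loop then weighs 3R.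
  a : Fin 3 → Fin m → ℕ
  a i j = ∣ u i (f j) ℤ.+ + R ∣

  level : ℕ
  level = 3 * R

  R-bound : ∀ i j → ∣ u i (f j) ∣ ≤ R
  R-bound i j = ≤-trans (≤-∑ (λ i → ∣ u i (f j) ∣) i) (≤-∑ (λ j → ∑[ i < 3 ] ∣ u i (f j) ∣) j)

  shifted : (j : Fin 3 → Fin m) {x : Fin 3 → V G} → (∀ i → x i ≡ f (j i)) →
            + ∑[ i < 3 ] a i (j i) ≡ sumFin (λ i → u i (x i)) ℤ.+ + level
  shifted j x≡ = trans (∑-shift R (λ i → u i (f (j i))) (λ i → ∣i∣≤n⇒0≤i+n {u i (f (j i))} (R-bound i (j i))))
                       (cong (ℤ._+ + level) (sym (sumFin-cong (λ i → cong (u i) (x≡ i)))))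

  coordinate-weight : (j : Fin 3 → Fin m) {x : Fin 3 → V G} {d : Bool} → (∀ i → x i ≡ f (j i)) →
                      EdgeOrLoop G x d → StrictIf d level (∑[ i < 3 ] a i (j i))
  coordinate-weight j {x} x≡ (edge e) = ℤ.drop‿+<+ (subst (+ level ℤ.<_) (sym (shifted j x≡))
    (ℤ.+-monoˡ-< (+ level) (u-pos x (inj₁ e) λ (v , _ , c) → G-loopless v e c)))
  coordinate-weight j {x} x≡ (loop v c) = sym (ℤ.+-injective (trans (shifted j x≡)
    (cong (ℤ._+ + level) (u-zero x (v , (j zero , trans (sym (c zero)) (x≡ zero)) , c)))))

  enc : (Fin n → Fin m) → V (G ^⊠ n)
  enc {zero}  w = tt
  enc {suc n} w = enc (w ∘ suc) , f (w zero)

  enc-injective : ∀ {w w′ : Fin n → Fin m} → enc w ≡ enc w′ → ∀ c → w c ≡ w′ c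
  enc-injective {suc n} eq zero    = f-inj (cong proj₂ eq)
  enc-injective {suc n} eq (suc c) = enc-injective (cong proj₁ eq) c

  W : Fin 3 → (Fin n → Fin m) → ℕ
  W {n} i w = ∑[ c < n ] a i (w c)

  total : (Fin 3 → Fin n → Fin m) → ℕ
  total w = ∑[ i < 3 ] W i (w i)

  power-weight : (w : Fin 3 → Fin n → Fin m) {x : Fin 3 → V (G ^⊠ n)} {b : Bool} →
                 (∀ i → x i ≡ enc (w i)) → EdgeOrLoop (G ^⊠ n) x b → StrictIf b (n * level) (total w)
  power-weight {zero} w x≡ el rewrite 𝟙-loop el = refl
  power-weight {suc n} w x≡ el with ⊠-split el
  ... | c , d , el′ , el₀ , refl =
    subst₂ (λ b t → StrictIf b (suc n * level) t) (∨-comm d c)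
      (sym (∑-distrib-+ (λ i → a i (w i zero)) (λ i → W i (w i ∘ suc))))
      (StrictIf-+ d c (coordinate-weight (λ i → w i zero) (cong proj₂ ∘ x≡) el₀)
                      (power-weight (λ i → w i ∘ suc) (cong proj₁ ∘ x≡) el′))

  total-diagonal : (w : Fin n → Fin m) → total (λ _ → w) ≡ n * level
  total-diagonal w = sym (power-weight (λ _ → w) (λ _ → refl) (loop (enc w) (λ _ → refl)))

  equal-weights-not-edge : (w : Fin 3 → Fin n → Fin m) → W zero (w zero) ≡ W zero (w (# 2)) →
                      W (# 1) (w (# 1)) ≡ W (# 1) (w (# 2)) →
                      ∀ {x} → (∀ i → x i ≡ enc (w i)) → ¬ E (G ^⊠ n) x
  equal-weights-not-edge {n} w eq₀ eq₁ x≡ e = <-irrefl (sym balanced) (power-weight w x≡ (edge e))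
    where
    balanced : total w ≡ n * level
    balanced = trans (cong₂ _+_ eq₀ (cong (_+ (W (# 2) (w (# 2)) + 0)) eq₁)) (total-diagonal (w (# 2)))

  weightBound : ℕ
  weightBound = ∑[ j < m ] ∑[ i < 3 ] a i j

  W-bound : ∀ i (w : Fin n → Fin m) → W i w ≤ n * weightBound
  W-bound i w = ∑-bound (λ c → a i (w c)) λ c →
    ≤-trans (≤-∑ (λ i → a i (w c)) i) (≤-∑ (λ j → ∑[ i < 3 ] a i j) (w c))

  W-index : Fin 3 → (Fin n → Fin m) → Fin (suc (n * weightBound))
  W-index i w = fromℕ< (s≤s (W-bound i w))

  class : (Fin n → Fin m) → Fin (suc (n * weightBound) * suc (n * weightBound))
  class w = combine (W-index zero w) (W-index (# 1) w)

  class-weights : ∀ {w w′ : Fin n → Fin m} → class w ≡ class w′ →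
                  W zero w ≡ W zero w′ × W (# 1) w ≡ W (# 1) w′
  class-weights {n} {w} {w′} eq =
    Fin.fromℕ<-injective _ _ _ _ (Fin.combine-injectiveˡ i₀ i₁ i₀′ i₁′ eq) ,
    Fin.fromℕ<-injective _ _ _ _ (Fin.combine-injectiveʳ i₀ i₁ i₀′ i₁′ eq)
    where
    i₀ i₁ i₀′ i₁′ : Fin (suc (n * weightBound))
    i₀ = W-index zero w ; i₁ = W-index (# 1) w ; i₀′ = W-index zero w′ ; i₁′ = W-index (# 1) w′

  α≥-^⊠ : ∀ n → ∃ λ M → α≥ (G ^⊠ n) M × m ^ n ≤ suc (n * weightBound) * suc (n * weightBound) * M
  α≥-^⊠ n with pigeonhole (class ∘ finToFun {m} {n})
  ... | c , M , g , g-inj , g-cls , bound = M , (vertex , vertex-inj , independent) , bound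
    where
    word : Fin M → Fin n → Fin m
    word = finToFun ∘ g
    vertex : Fin M → V (G ^⊠ n)
    vertex = enc ∘ word
    vertex-inj : Injective _≡_ _≡_ vertex
    vertex-inj = g-inj ∘ finToFun-injective ∘ enc-injective
    independent : IsIndependent (G ^⊠ n) vertex
    independent e e-edge e∈ =
      equal-weights-not-edge w (proj₁ (class-weights {n} (same zero))) (proj₂ (class-weights {n} (same (# 1))))
        (proj₂ ∘ e∈) e-edge
      where
      w : Fin 3 → Fin n → Fin m
      w i = word (proj₁ (e∈ i))
      same : ∀ i → class (w i) ≡ class (w (# 2))
      same i = trans (g-cls _) (sym (g-cls _))

β≥⇒α≥-^⊠ : {G : Hypergraph 3} → Loopless G → β≥ G m →
           ∃ λ B → ∀ n → ∃ λ M → α≥ (G ^⊠ n) M × m ^ n ≤ suc (n * B) * suc (n * B) * M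
β≥⇒α≥-^⊠ G-loopless (f , f-inj , u , u-pos , u-zero) = weightBound , α≥-^⊠
  where open PowerWeights G-loopless f f-inj u u-pos u-zero

-- Growth of powers

bernoulli : ∀ P t → t * P ^ t ≤ suc P ^ suc t
bernoulli P zero    = z≤n
bernoulli P (suc t) = begin
  P ^ suc t + t * (P * P ^ t)
    ≡⟨ cong (λ x → P ^ suc t + x) (solve 3 (λ t P x → t :* (P :* x) := P :* (t :* x)) refl t P (P ^ t)) ⟩
  P ^ suc t + P * (t * P ^ t)
    ≤⟨ +-mono-≤ (^-monoˡ-≤ (suc t) (n≤1+n P)) (*-monoʳ-≤ P (bernoulli P t)) ⟩
  suc P ^ suc (suc t) ∎
  where open ≤-Reasoning

*-^ : ∀ x y n → (x * y) ^ n ≡ x ^ n * y ^ n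
*-^ x y zero    = refl
*-^ x y (suc n) = trans (cong (x * y *_) (*-^ x y n))
  (solve 4 (λ x y a b → x :* y :* (a :* b) := x :* a :* (y :* b)) refl x y (x ^ n) (y ^ n))

-- Bernoulli's inequality, cubed, beats any quadratic factor.
cube-growth : ∀ P A → ∃ λ T → ∀ t → T ≤ t → A * (suc t * suc t) * (P ^ t) ^ 3 ≤ (suc P ^ t) ^ 3
cube-growth P A = suc (A * D * 4) , λ t T≤t → *-cancelˡ-≤ D (begin
  D * (A * (suc t * suc t) * (P ^ t) ^ 3)
    ≡⟨ solve 4 (λ d a s x → d :* (a :* s :* x) := a :* d :* s :* x) refl D A (suc t * suc t) ((P ^ t) ^ 3) ⟩
  A * D * (suc t * suc t) * (P ^ t) ^ 3
    ≤⟨ *-monoˡ-≤ ((P ^ t) ^ 3) (coefficient t T≤t) ⟩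
  t ^ 3 * (P ^ t) ^ 3
    ≡⟨ *-^ t (P ^ t) 3 ⟨
  (t * P ^ t) ^ 3
    ≤⟨ ^-monoˡ-≤ 3 (bernoulli P t) ⟩
  (suc P * suc P ^ t) ^ 3
    ≡⟨ *-^ (suc P) (suc P ^ t) 3 ⟩
  D * (suc P ^ t) ^ 3 ∎)
  where
  open ≤-Reasoning
  D : ℕ
  D = suc P ^ 3
  instance
    D≢0 : NonZero D
    D≢0 = m^n≢0 (suc P) 3
  coefficient : ∀ t → suc (A * D * 4) ≤ t → A * D * (suc t * suc t) ≤ t ^ 3
  coefficient t@(suc t-1) (s≤s AD4≤t-1) = begin
    A * D * (suc t * suc t)
      ≤⟨ *-monoʳ-≤ (A * D) (*-mono-≤ suc-t≤2t suc-t≤2t) ⟩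
    A * D * ((2 * t) * (2 * t))
      ≡⟨ solve 3 (λ a d t → a :* d :* ((con 2 :* t) :* (con 2 :* t)) := a :* d :* con 4 :* (t :* t)) refl A D t ⟩
    A * D * 4 * (t * t)
      ≤⟨ *-monoˡ-≤ (t * t) (m≤n⇒m≤1+n AD4≤t-1) ⟩
    t * (t * t)
      ≡⟨ cong (λ x → t * (t * x)) (*-identityʳ t) ⟨
    t ^ 3 ∎
    where
    suc-t≤2t : suc t ≤ 2 * t
    suc-t≤2t = subst (suc t ≤_) (cong (λ x → t + x) (sym (+-identityʳ t))) (+-monoˡ-≤ t (s≤s z≤n))

1+m*n≤[1+m]*[1+n] : ∀ m n → suc (m * n) ≤ suc m * suc n
1+m*n≤[1+m]*[1+n] m n = s≤s (≤-trans (*-monoʳ-≤ m (n≤1+n n)) (m≤n+m (m * suc n) n))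

-- For n = r + 3t·a and P = p^a:  p^n · classes ≤ (P + 1)^(3t) ≤ b^(3t) · q^(3t·a) ≤ classes · M · q^n,
-- where `classes` bounds the number of weight classes of words of length 3t over S ⊆ V(G^⊠a).
power-comparison : ∀ {p q b} a B .{{_ : NonZero q}} → p ^ a < b * q ^ a →
  ∃ λ T → ∀ t r M → T ≤ t → r ≤ 3 * a → b ^ (t * 3) ≤ suc (t * 3 * B) * suc (t * 3 * B) * M →
  p ^ (r + t * 3 * a) ≤ q ^ (r + t * 3 * a) * M
power-comparison {p} {q} {b} a B lt =
  proj₁ (cube-growth (p ^ a) constant) , λ t r M T≤t r≤3a bound → *-cancelˡ-≤ (classes t) (begin
    classes t * p ^ (r + t * 3 * a)
      ≡⟨ cong (classes t *_) (trans (^-distribˡ-+-* p r (t * 3 * a)) (cong (p ^ r *_) (sym (blocks p t)))) ⟩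
    classes t * (p ^ r * ((p ^ a) ^ t) ^ 3)
      ≡⟨ *-assoc (classes t) (p ^ r) _ ⟨
    classes t * p ^ r * ((p ^ a) ^ t) ^ 3
      ≤⟨ *-monoˡ-≤ _ (prefactor t r r≤3a) ⟩
    constant * (suc t * suc t) * ((p ^ a) ^ t) ^ 3
      ≤⟨ proj₂ (cube-growth (p ^ a) constant) t T≤t ⟩
    (suc (p ^ a) ^ t) ^ 3
      ≤⟨ ^-monoˡ-≤ 3 (^-monoˡ-≤ t lt) ⟩
    ((b * q ^ a) ^ t) ^ 3
      ≡⟨ trans (cong (_^ 3) (*-^ b (q ^ a) t)) (*-^ (b ^ t) ((q ^ a) ^ t) 3) ⟩
    (b ^ t) ^ 3 * ((q ^ a) ^ t) ^ 3
      ≡⟨ cong₂ _*_ (^-*-assoc b t 3) (blocks q t) ⟩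
    b ^ (t * 3) * q ^ (t * 3 * a)
      ≤⟨ *-mono-≤ bound (^-monoʳ-≤ q (m≤n+m (t * 3 * a) r)) ⟩
    classes t * M * q ^ (r + t * 3 * a)
      ≡⟨ solve 3 (λ k m x → k :* m :* x := k :* (x :* m)) refl (classes t) M (q ^ (r + t * 3 * a)) ⟩
    classes t * (q ^ (r + t * 3 * a) * M) ∎)
  where
  open ≤-Reasoning
  classes : ℕ → ℕ
  classes t = suc (t * 3 * B) * suc (t * 3 * B)
  constant : ℕ
  constant = suc (3 * B) * suc (3 * B) * suc p ^ (3 * a)
  blocks : ∀ x t → ((x ^ a) ^ t) ^ 3 ≡ x ^ (t * 3 * a)
  blocks x t = trans (^-*-assoc (x ^ a) t 3) (trans (^-*-assoc x a (t * 3)) (cong (x ^_) (*-comm a (t * 3))))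
  prefactor : ∀ t r → r ≤ 3 * a → classes t * p ^ r ≤ constant * (suc t * suc t)
  prefactor t r r≤3a = begin
    classes t * p ^ r
      ≤⟨ *-mono-≤ (*-mono-≤ count≤ count≤) (≤-trans (^-monoˡ-≤ r (n≤1+n p)) (^-monoʳ-≤ (suc p) r≤3a)) ⟩
    suc t * suc (3 * B) * (suc t * suc (3 * B)) * suc p ^ (3 * a)
      ≡⟨ solve 3 (λ t c x → t :* c :* (t :* c) :* x := c :* c :* x :* (t :* t)) refl (suc t) (suc (3 * B)) _ ⟩
    constant * (suc t * suc t) ∎
    where
    count≤ : suc (t * 3 * B) ≤ suc t * suc (3 * B)
    count≤ = subst (λ x → suc x ≤ suc t * suc (3 * B)) (sym (*-assoc t 3 B)) (1+m*n≤[1+m]*[1+n] t (3 * B))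

base-nonZero : ∀ {p q b} a .{{_ : NonZero a}} → p ^ a < b * q ^ a → NonZero q
base-nonZero {q = suc _} _ _ = _
base-nonZero {p} {zero} {b} (suc a) lt = contradiction (subst (p ^ suc a <_) (*-zeroʳ b) lt) n≮0

capacity-lower-bound : {G : Hypergraph 3} → Loopless G → V G →
  ∀ a .{{_ : NonZero a}} {b} → β≥ (G ^⊠ a) b → ∀ p q → p ^ a < b * q ^ a →
  ∃ λ N → ∀ n → N ≤ n → Σ ℕ λ M → α≥ (G ^⊠ n) M × p ^ n ≤ q ^ n * M
capacity-lower-bound {G = G} G-loopless g a {b} β p q lt = threshold * (3 * a) , large
  where
  instance
    q≢0 : NonZero q
    q≢0 = base-nonZero {p} {q} {b} a lt
    3a≢0 : NonZero (3 * a)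
    3a≢0 = m*n≢0 3 a
  κ : ℕ
  κ = proj₁ (β≥⇒α≥-^⊠ (^⊠-loopless G-loopless a) β)
  α-power : ∀ k → ∃ λ M → α≥ ((G ^⊠ a) ^⊠ k) M × b ^ k ≤ suc (k * κ) * suc (k * κ) * M
  α-power = proj₂ (β≥⇒α≥-^⊠ (^⊠-loopless G-loopless a) β)
  threshold : ℕ
  threshold = proj₁ (power-comparison {p} {q} {b} a κ lt)
  large : ∀ n → threshold * (3 * a) ≤ n → Σ ℕ λ M → α≥ (G ^⊠ n) M × p ^ n ≤ q ^ n * M
  large n threshold*3a≤n =
    M , subst (λ n → α≥ (G ^⊠ n) M) (sym n≡) (α≥-^⊠-+ G-loopless g r (α≥-pullback (^⊠-* (t * 3) a) α)) ,
        subst (λ n → p ^ n ≤ q ^ n * M) (sym n≡)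
              (proj₂ (power-comparison a κ lt) t r M threshold≤t (<⇒≤ (m%n<n n (3 * a))) bound)
    where
    t r M : ℕ
    t = n / (3 * a)
    r = n % (3 * a)
    M = proj₁ (α-power (t * 3))
    α : α≥ ((G ^⊠ a) ^⊠ (t * 3)) M
    α = proj₁ (proj₂ (α-power (t * 3)))
    bound : b ^ (t * 3) ≤ suc (t * 3 * κ) * suc (t * 3 * κ) * M
    bound = proj₂ (proj₂ (α-power (t * 3)))
    n≡ : n ≡ r + t * 3 * a
    n≡ = trans (m≡m%n+[m/n]*n n (3 * a)) (cong (λ x → r + x) (sym (*-assoc t 3 a)))
    threshold≤t : threshold ≤ t
    threshold≤t = subst (_≤ t) (m*n/n≡m threshold (3 * a)) (/-monoˡ-≤ (3 * a) threshold*3a≤n)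

-- Degeneration certificates

module _ {G : Hypergraph k} (_≟_ : DecidableEquality (V G)) (S : Fin m → V G)
         (on : Fin m → Fin k → ℤ) (off : Fin k → ℤ) where

  weight : V G → Fin k → ℤ
  weight v with Fin.any? (λ j → v ≟ S j)
  ... | yes (j , _) = on j
  ... | no _        = off

  β≥-by-weights : Injective _≡_ _≡_ S → (∀ j → sumFin (on j) ≡ 0ℤ) → 0ℤ ℤ.< sumFin off →
                  (∀ x → E G x → 0ℤ ℤ.< sumFin (λ i → weight (x i) i)) → β≥ G m
  β≥-by-weights S-inj on-zero off-pos edge-pos = S , S-inj , (λ i v → weight v i) , pos , zero-on-S
    where
    at-const : ∀ {x v} → IsConst x v → sumFin (λ i → weight (x i) i) ≡ sumFin (weight v)
    at-const c = sumFin-cong (λ i → cong (λ y → weight y i) (c i))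
    on-S : ∀ v → v ∈S S → sumFin (weight v) ≡ 0ℤ
    on-S v v∈ with Fin.any? (λ j → v ≟ S j)
    ... | yes (j , _) = on-zero j
    ... | no v∉       = ⊥-elim (v∉ v∈)
    off-S : ∀ v → ¬ v ∈S S → 0ℤ ℤ.< sumFin (weight v)
    off-S v v∉ with Fin.any? (λ j → v ≟ S j)
    ... | yes v∈ = ⊥-elim (v∉ v∈)
    ... | no _   = off-pos
    pos : ∀ x → E G x ⊎ (∃ λ v → IsConst x v) → ¬ (∃ λ v → v ∈S S × IsConst x v) →
          0ℤ ℤ.< sumFin (λ i → weight (x i) i)
    pos x (inj₁ e)       _     = edge-pos x e
    pos x (inj₂ (v , c)) not-Φ = subst (0ℤ ℤ.<_) (sym (at-const c)) (off-S v λ v∈ → not-Φ (v , v∈ , c))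
    zero-on-S : ∀ x → (∃ λ v → v ∈S S × IsConst x v) → sumFin (λ i → weight (x i) i) ≡ 0ℤ
    zero-on-S x (v , v∈ , c) = trans (at-const c) (on-S v v∈)

V₁ : Set
V₁ = Fin 2 × Fin 2

corner : Bool → V₁ → Fin 3 → V₁
corner false v         _                = v
corner true  (g₁ , g₂) zero             = g₁ , g₂
corner true  (g₁ , g₂) (suc zero)       = g₁ ⊕ (# 1) , g₂
corner true  (g₁ , g₂) (suc (suc zero)) = g₁ , g₂ ⊕ (# 1)

corner-shape : ∀ {x b} → EdgeOrLoop Hcor𝔽₂ x b → ∃ λ t → ∀ i → x i ≡ corner b t i
corner-shape (edge (_ , _ , zero , 0≢0 , _)) = ⊥-elim (0≢0 refl)
corner-shape (edge (g₁ , g₂ , suc zero , _ , e₀ , e₁ , e₂)) =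
  (g₁ , g₂) , λ { zero → e₀ ; (suc zero) → e₁ ; (suc (suc zero)) → e₂ }
corner-shape (loop v c) = v , c

Hcor-loopless : Loopless Hcor𝔽₂
Hcor-loopless {x} v e c with corner-shape {x} (edge e)
... | (g₁ , _) , x≡ =
  g⊕1≢g g₁ (cong proj₁ (trans (sym (x≡ (# 1))) (trans (c (# 1)) (trans (sym (c zero)) (x≡ zero)))))
  where
  g⊕1≢g : ∀ g → g ⊕ (# 1) ≢ g
  g⊕1≢g zero       ()
  g⊕1≢g (suc zero) ()

Exhaustible : Set → Set₁
Exhaustible X = ∀ {P : X → Set} → Decidable P → Dec (∀ x → P x)

⊤-exhaustible : Exhaustible ⊤
⊤-exhaustible P? = map′ (λ p _ → p) (λ p → p tt) (P? tt)

Bool-exhaustible : Exhaustible Bool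
Bool-exhaustible P? =
  map′ (λ { (p , _) false → p ; (_ , q) true → q }) (λ p → p false , p true) (P? false ×-dec P? true)

×-exhaustible : ∀ {X Y} → Exhaustible X → Exhaustible Y → Exhaustible (X × Y)
×-exhaustible ∀X? ∀Y? P? =
  map′ (λ p (x , y) → p x y) (λ p x y → p (x , y)) (∀X? λ x → ∀Y? λ y → P? (x , y))

Vertex : ℕ → Set
Vertex n = V (Hcor𝔽₂ ^⊠ n)

_≟ᵥ_ : ∀ {n} → DecidableEquality (Vertex n)
_≟ᵥ_ {zero}  _ _ = yes refl
_≟ᵥ_ {suc n} = ≡-dec (_≟ᵥ_ {n}) (≡-dec Fin._≟_ Fin._≟_)

-- Every edge or loop of Hcor𝔽₂ ^⊠ n is `tuple σ` for one of these finitely many shapes σ, so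
-- properties of all edges can be decided.
Shape : ℕ → Set
Shape zero    = ⊤
Shape (suc n) = Shape n × Bool × V₁

Shape-exhaustible : ∀ n → Exhaustible (Shape n)
Shape-exhaustible zero    = ⊤-exhaustible
Shape-exhaustible (suc n) =
  ×-exhaustible (Shape-exhaustible n) (×-exhaustible Bool-exhaustible (×-exhaustible Fin.all? Fin.all?))

tuple : ∀ {n} → Shape n → Fin 3 → Vertex n
tuple {zero}  _           _ = tt
tuple {suc n} (σ , b , t) i = tuple {n} σ i , corner b t i

isEdge : ∀ {n} → Shape n → Bool
isEdge {zero}  _           = false
isEdge {suc n} (σ , b , _) = isEdge {n} σ ∨ b

power-shape : ∀ n {x b} → EdgeOrLoop (Hcor𝔽₂ ^⊠ n) x b →
              ∃ λ σ → (∀ i → x i ≡ tuple σ i) × b ≡ isEdge {n} σ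
power-shape zero    el = tt , (λ _ → refl) , 𝟙-loop el
power-shape (suc n) el with ⊠-split el
... | c , d , el′ , el₀ , refl with power-shape n el′ | corner-shape el₀
... | σ , x≡ , refl | t , y≡ = (σ , d , t) , (λ i → cong₂ _,_ (x≡ i) (y≡ i)) , refl

balanced : ℕ × ℕ → Fin 3 → ℤ
balanced (a , b) zero             = + a
balanced (a , b) (suc zero)       = + b
balanced (a , b) (suc (suc zero)) = - (+ a ℤ.+ + b)

balanced-sum : ∀ ab → sumFin (balanced ab) ≡ 0ℤ
balanced-sum (a , b) = begin
  + a ℤ.+ (+ b ℤ.+ (- c ℤ.+ 0ℤ))  ≡⟨ cong (λ x → + a ℤ.+ (+ b ℤ.+ x)) (ℤ.+-identityʳ (- c)) ⟩
  + a ℤ.+ (+ b ℤ.+ - c)          ≡⟨ ℤ.+-assoc (+ a) (+ b) (- c) ⟨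
  c ℤ.+ - c                      ≡⟨ ℤ.+-inverseʳ c ⟩
  0ℤ                              ∎
  where
  open ≡-Reasoning
  c : ℤ
  c = + a ℤ.+ + b

-- A table lists S with the first two weights (a , b) of each element; the third is -(a + b).
module CornerTable (n : ℕ) (table : Vec (Vertex n × ℕ × ℕ) m) where

  S : Fin m → Vertex n
  S = proj₁ ∘ lookup table

  -- Outside S every coordinate weighs 1000, enough to keep the edges through such vertices positive.
  weightOf : Vertex n → Fin 3 → ℤ
  weightOf = weight {G = Hcor𝔽₂ ^⊠ n} (_≟ᵥ_ {n}) S (balanced ∘ proj₂ ∘ lookup table) (λ _ → + 1000)

  injective? : Dec (∀ i j → S i ≡ S j → i ≡ j)
  injective? = Fin.all? λ i → Fin.all? λ j → _≟ᵥ_ {n} (S i) (S j) →-dec i Fin.≟ j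

  positive-on-edges? :
    Dec (∀ σ → T (isEdge {n} σ) → 0ℤ ℤ.< sumFin (λ i → weightOf (tuple {n} σ i) i))
  positive-on-edges? = Shape-exhaustible n λ σ →
    T? (isEdge {n} σ) →-dec (0ℤ ℤ.<? sumFin (λ i → weightOf (tuple {n} σ i) i))

  β≥-from-table : True injective? → True positive-on-edges? → β≥ (Hcor𝔽₂ ^⊠ n) m
  β≥-from-table inj pos =
    β≥-by-weights (_≟ᵥ_ {n}) S _ _ (toWitness inj _ _) (balanced-sum ∘ proj₂ ∘ lookup table)
      (ℤ.+<+ (s≤s z≤n)) edges-positive
    where
    edges-positive : ∀ x → E (Hcor𝔽₂ ^⊠ n) x → 0ℤ ℤ.< sumFin (λ i → weightOf (x i) i)
    edges-positive x e with power-shape n (edge e)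
    ... | σ , x≡ , is-edge =
      subst (0ℤ ℤ.<_) (sym (sumFin-cong λ i → cong (λ v → weightOf v i) (x≡ i)))
            (toWitness pos σ (subst T is-edge tt))

table₂ : Vec (Vertex 2 × ℕ × ℕ) 11
table₂ =
    (((tt , (# 0 , # 1)) , (# 0 , # 0)) , 3 , 11)
  ∷ (((tt , (# 0 , # 0)) , (# 0 , # 1)) , 7 , 10)
  ∷ (((tt , (# 0 , # 1)) , (# 0 , # 1)) , 10 , 0)
  ∷ (((tt , (# 1 , # 0)) , (# 0 , # 0)) , 3 , 7)
  ∷ (((tt , (# 1 , # 1)) , (# 0 , # 0)) , 0 , 9)
  ∷ (((tt , (# 1 , # 1)) , (# 0 , # 1)) , 2 , 8)
  ∷ (((tt , (# 0 , # 0)) , (# 1 , # 0)) , 2 , 8)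
  ∷ (((tt , (# 0 , # 1)) , (# 1 , # 0)) , 2 , 8)
  ∷ (((tt , (# 0 , # 0)) , (# 1 , # 1)) , 1 , 9)
  ∷ (((tt , (# 1 , # 0)) , (# 1 , # 1)) , 2 , 8)
  ∷ (((tt , (# 1 , # 1)) , (# 1 , # 1)) , 2 , 8)
  ∷ []

table₃ : Vec (Vertex 3 × ℕ × ℕ) 39
table₃ =
    ((((tt , (# 0 , # 0)) , (# 0 , # 0)) , (# 0 , # 0)) , 21 , 56)
  ∷ ((((tt , (# 0 , # 1)) , (# 0 , # 0)) , (# 0 , # 0)) , 28 , 55)
  ∷ ((((tt , (# 0 , # 0)) , (# 0 , # 1)) , (# 0 , # 0)) , 69 , 0)
  ∷ ((((tt , (# 0 , # 0)) , (# 0 , # 0)) , (# 0 , # 1)) , 27 , 54)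
  ∷ ((((tt , (# 0 , # 0)) , (# 0 , # 1)) , (# 0 , # 1)) , 3 , 70)
  ∷ ((((tt , (# 0 , # 1)) , (# 0 , # 1)) , (# 0 , # 1)) , 31 , 42)
  ∷ ((((tt , (# 1 , # 1)) , (# 0 , # 0)) , (# 0 , # 0)) , 21 , 55)
  ∷ ((((tt , (# 1 , # 0)) , (# 0 , # 1)) , (# 0 , # 0)) , 71 , 54)
  ∷ ((((tt , (# 1 , # 1)) , (# 0 , # 1)) , (# 0 , # 0)) , 15 , 55)
  ∷ ((((tt , (# 1 , # 1)) , (# 0 , # 1)) , (# 0 , # 1)) , 17 , 56)
  ∷ ((((tt , (# 0 , # 0)) , (# 1 , # 1)) , (# 0 , # 0)) , 21 , 29)
  ∷ ((((tt , (# 0 , # 0)) , (# 1 , # 0)) , (# 0 , # 1)) , 0 , 54)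
  ∷ ((((tt , (# 0 , # 1)) , (# 1 , # 0)) , (# 0 , # 1)) , 1 , 57)
  ∷ ((((tt , (# 0 , # 1)) , (# 1 , # 1)) , (# 0 , # 1)) , 17 , 56)
  ∷ ((((tt , (# 1 , # 0)) , (# 1 , # 1)) , (# 0 , # 0)) , 55 , 15)
  ∷ ((((tt , (# 1 , # 1)) , (# 1 , # 1)) , (# 0 , # 0)) , 21 , 62)
  ∷ ((((tt , (# 1 , # 1)) , (# 1 , # 0)) , (# 0 , # 1)) , 19 , 54)
  ∷ ((((tt , (# 1 , # 0)) , (# 1 , # 1)) , (# 0 , # 1)) , 4 , 69)
  ∷ ((((tt , (# 1 , # 1)) , (# 1 , # 1)) , (# 0 , # 1)) , 18 , 55)
  ∷ ((((tt , (# 0 , # 1)) , (# 0 , # 0)) , (# 1 , # 0)) , 19 , 55)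
  ∷ ((((tt , (# 0 , # 1)) , (# 0 , # 1)) , (# 1 , # 0)) , 21 , 54)
  ∷ ((((tt , (# 0 , # 0)) , (# 0 , # 0)) , (# 1 , # 1)) , 22 , 51)
  ∷ ((((tt , (# 0 , # 1)) , (# 0 , # 0)) , (# 1 , # 1)) , 19 , 54)
  ∷ ((((tt , (# 0 , # 0)) , (# 0 , # 1)) , (# 1 , # 1)) , 6 , 67)
  ∷ ((((tt , (# 1 , # 0)) , (# 0 , # 0)) , (# 1 , # 0)) , 18 , 55)
  ∷ ((((tt , (# 1 , # 1)) , (# 0 , # 0)) , (# 1 , # 0)) , 19 , 54)
  ∷ ((((tt , (# 1 , # 1)) , (# 0 , # 0)) , (# 1 , # 1)) , 8 , 65)
  ∷ ((((tt , (# 1 , # 0)) , (# 0 , # 1)) , (# 1 , # 1)) , 7 , 53)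
  ∷ ((((tt , (# 1 , # 1)) , (# 0 , # 1)) , (# 1 , # 1)) , 19 , 54)
  ∷ ((((tt , (# 0 , # 0)) , (# 1 , # 0)) , (# 1 , # 0)) , 19 , 54)
  ∷ ((((tt , (# 0 , # 1)) , (# 1 , # 1)) , (# 1 , # 0)) , 19 , 54)
  ∷ ((((tt , (# 0 , # 0)) , (# 1 , # 0)) , (# 1 , # 1)) , 21 , 52)
  ∷ ((((tt , (# 0 , # 1)) , (# 1 , # 0)) , (# 1 , # 1)) , 20 , 53)
  ∷ ((((tt , (# 0 , # 1)) , (# 1 , # 1)) , (# 1 , # 1)) , 20 , 53)
  ∷ ((((tt , (# 1 , # 0)) , (# 1 , # 0)) , (# 1 , # 0)) , 20 , 53)
  ∷ ((((tt , (# 1 , # 1)) , (# 1 , # 0)) , (# 1 , # 0)) , 20 , 53)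
  ∷ ((((tt , (# 1 , # 0)) , (# 1 , # 1)) , (# 1 , # 0)) , 20 , 53)
  ∷ ((((tt , (# 1 , # 1)) , (# 1 , # 1)) , (# 1 , # 0)) , 20 , 53)
  ∷ ((((tt , (# 1 , # 0)) , (# 1 , # 0)) , (# 1 , # 1)) , 20 , 53)
  ∷ []

theorem2p18 : β≥ (Hcor𝔽₂ ^⊠ 2) 11
    × β≥ (Hcor𝔽₂ ^⊠ 3) 39
    × (∀ (p q : ℕ) → p ^ 3 < 39 * q ^ 3 →
    ∃ λ N → ∀ n → N ≤ n → Σ ℕ λ m → α≥ (Hcor𝔽₂ ^⊠ n) m × p ^ n ≤ q ^ n * m)
theorem2p18 = β₂ , β₃ , capacity-lower-bound Hcor-loopless (# 0 , # 0) 3 β₃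
  where
  β₂ : β≥ (Hcor𝔽₂ ^⊠ 2) 11
  β₂ = CornerTable.β≥-from-table 2 table₂ tt tt
  β₃ : β≥ (Hcor𝔽₂ ^⊠ 3) 39
  β₃ = CornerTable.β≥-from-table 3 table₃ tt tt
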